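{- Let $n>16$ be an integer and let $N=\lceil\sqrt{n}\,\rceil$. If $N\mid (n-1)$ or $N\mid \left(n-1+\left\lfloor\frac{n-1}{N}\right\rfloor\right)$, then $O\chi(C_n)=N$.
   Context: $C_n$ denotes the cycle graph on $n$ vertices. All colourings are proper vertex colourings. Two colourings $c_1,c_2$ of a graph are orthogonal if whenever two distinct vertices receive the same colour in one colouring, they receive distinct colours in the other (equivalently, no colour pair $(c_1(v),c_2(v))$ occurs at two distinct vertices). An orthogonal colouring is a pair of orthogonal proper colourings; $O\chi(G)$, the orthogonal chromatic number, is the minimum number of colours needed for an orthogonal colouring of $G$ (both colourings drawing from the same set of that many colours). -}

module Defs where

open import Data.Nat using (ℕ; zero; suc; _+_; _*_; _∸_; _≤_; _<_; NonZero)
open import Data.Nat.DivMod using (_%_; _/_)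
open import Data.Fin using (Fin; toℕ)
open import Data.Product using (Σ; _×_; _,_)
open import Data.Sum using (_⊎_)
open import Relation.Binary.PropositionalEquality using (_≡_)
open import Relation.Nullary using (¬_)

CycleAdj : (n : ℕ) .{{_ : NonZero n}} → Fin n → Fin n → Set
CycleAdj n i j = (toℕ j ≡ (toℕ i + 1) % n) ⊎ (toℕ i ≡ (toℕ j + 1) % n)

Colouring : ℕ → ℕ → Set
Colouring n k = Fin n → Fin k

Proper : (n : ℕ) .{{_ : NonZero n}} {k : ℕ} → Colouring n k → Set
Proper n c = ∀ i j → CycleAdj n i j → ¬ (c i ≡ c j)

Orthogonal : {n k : ℕ} → Colouring n k → Colouring n k → Set
Orthogonal c₁ c₂ = ∀ u v → c₁ u ≡ c₁ v → c₂ u ≡ c₂ v → u ≡ v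

HasOrthColouring : (n : ℕ) .{{_ : NonZero n}} → ℕ → Set
HasOrthColouring n k =
  Σ (Colouring n k) λ c₁ → Σ (Colouring n k) λ c₂ →
    Proper n c₁ × Proper n c₂ × Orthogonal c₁ c₂

OChiCycle≡ : (n : ℕ) .{{_ : NonZero n}} → ℕ → Set
OChiCycle≡ n k = HasOrthColouring n k × (∀ m → m < k → ¬ HasOrthColouring n m)

IsCeilSqrt : ℕ → ℕ → Set
IsCeilSqrt n N = n ≤ N * N × (∀ m → m < N → m * m < n)

-- Number the vertices of C_n by 0, …, n − 1 and write v = r + q N with
-- 0 ≤ r, q < N (possible since n ≤ N²). Colour v by α r + β q mod N. Going
-- from v to v + 1 changes this colour by α, or by α + β when r wraps around,
-- so the colouring is proper along the path as long as 0 < α and α + β < N;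
-- two such colourings whose coefficient matrix is unimodular are orthogonal.
-- The only remaining edge is {n − 1, 0}, and each divisibility hypothesis
-- makes one such pair proper across it: if N ∣ n − 1 use
-- (α, β) = (1, 1) and (2, 1), and if N ∣ (n − 1) + ⌊(n − 1)/N⌋ use (1, 0) and
-- (2, 1). The lower bound is the pigeonhole principle: orthogonal colourings
-- with m colours give distinct colour pairs to all n vertices, so n ≤ m².
module Submission where

open import Defs
open import Data.Nat using (ℕ; suc; _+_; _∸_; _*_; _<_; _≤_; z≤n; s≤s; z<s; pred; NonZero; >-nonZero⁻¹)
open import Data.Nat.Properties
open import Data.Nat.DivMod
open import Data.Nat.Divisibility using (_∣_; divides-refl; n∣m⇒m%n≡0)
open import Data.Nat.Tactic.RingSolver using (solve-∀)
open import Data.Fin using (Fin; toℕ; fromℕ<; combine)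
open import Data.Fin.Properties using (toℕ-fromℕ<; toℕ-injective; toℕ<n; pigeonhole; combine-injective)
import Data.Fin.Properties as Fin
open import Data.Product using (_×_; _,_)
open import Data.Sum using (_⊎_; inj₁; inj₂)
open import Relation.Binary.PropositionalEquality
open import Relation.Nullary using (¬_)

module Residues (N : ℕ) .{{_ : NonZero N}} where

  open ≡-Reasoning

  infix 4 _≈_ _≉_

  _≈_ : ℕ → ℕ → Set
  a ≈ b = a % N ≡ b % N

  _≉_ : ℕ → ℕ → Set
  a ≉ b = ¬ (a ≈ b)

  +-cong-≈ : ∀ {a b c d} → a ≈ b → c ≈ d → a + c ≈ b + d
  +-cong-≈ {a} {b} {c} {d} a≈b c≈d = begin
    (a + c) % N           ≡⟨ %-distribˡ-+ a c N ⟩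
    (a % N + c % N) % N   ≡⟨ cong₂ (λ x y → (x + y) % N) a≈b c≈d ⟩
    (b % N + d % N) % N   ≡⟨ %-distribˡ-+ b d N ⟨
    (b + d) % N           ∎

  +-cancelʳ-≈ : ∀ a b {k l} → k ≈ l → a + k ≈ b + l → a ≈ b
  +-cancelʳ-≈ a b {k} {l} k≈l a+k≈b+l = begin
    a % N                     ≡⟨ [m+kn]%n≡m%n a k N ⟨
    (a + k * N) % N           ≡⟨ cong (_% N) (k*N-split a) ⟩
    (a + k + k * pred N) % N  ≡⟨ +-cong-≈ (trans a+k≈b+l (+-cong-≈ {b} refl (sym k≈l))) refl ⟩
    (b + k + k * pred N) % N  ≡⟨ cong (_% N) (k*N-split b) ⟨
    (b + k * N) % N           ≡⟨ [m+kn]%n≡m%n b k N ⟩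
    b % N                     ∎
    where
    k*N-split : ∀ x → x + k * N ≡ x + k + k * pred N
    k*N-split x = begin
      x + k * N                ≡⟨ cong (λ m → x + k * m) (suc-pred N) ⟨
      x + k * suc (pred N)     ≡⟨ cong (x +_) (*-suc k (pred N)) ⟩
      x + (k + k * pred N)     ≡⟨ +-assoc x k _ ⟨
      x + k + k * pred N       ∎

  <⇒≈⇒≡ : ∀ {a b} → a < N → b < N → a ≈ b → a ≡ b
  <⇒≈⇒≡ a<N b<N a≈b = trans (sym (m<n⇒m%n≡m a<N)) (trans a≈b (m<n⇒m%n≡m b<N))

  ≉-+ : ∀ a {k} → 0 < k → k < N → a ≉ a + k
  ≉-+ a {k} 0<k k<N a≈a+k = <⇒≢ 0<k (<⇒≈⇒≡ (>-nonZero⁻¹ N) k<N 0≈k)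
    where
    0≈k : 0 ≈ k
    0≈k = +-cancelʳ-≈ 0 k refl (trans a≈a+k (cong (_% N) (+-comm a k)))

  0%N≡0 : 0 % N ≡ 0
  0%N≡0 = m<n⇒m%n≡m (>-nonZero⁻¹ N)

  digits-injective : ∀ {u v} → u % N ≡ v % N → u / N ≡ v / N → u ≡ v
  digits-injective {u} {v} r≡ q≡ = begin
    u                   ≡⟨ m≡m%n+[m/n]*n u N ⟩
    u % N + u / N * N   ≡⟨ cong₂ (λ r q → r + q * N) r≡ q≡ ⟩
    v % N + v / N * N   ≡⟨ m≡m%n+[m/n]*n v N ⟨
    v                   ∎

  digits-unique : ∀ {r} q → r < N → (r + q * N) % N ≡ r × (r + q * N) / N ≡ q
  digits-unique {r} q r<N = trans ([m+kn]%n≡m%n r q N) (m<n⇒m%n≡m r<N) , (begin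
    (r + q * N) / N       ≡⟨ +-distrib-/-∣ʳ r (divides-refl q) ⟩
    r / N + q * N / N     ≡⟨ cong₂ _+_ (m<n⇒m/n≡0 r<N) (m*n/n≡m q N) ⟩
    q                     ∎)

  suc-digits : ∀ v → (suc v % N ≡ suc (v % N) × suc v / N ≡ v / N)
                   ⊎ (suc (v % N) ≡ N × suc v % N ≡ 0 × suc v / N ≡ suc (v / N))
  suc-digits v with m≤n⇒m<n∨m≡n (m%n<n v N)
  ... | inj₁ r+1<N = inj₁ (subst (λ w → w % N ≡ suc (v % N) × w / N ≡ v / N) (sym v+1≡) (digits-unique (v / N) r+1<N))
    where
    v+1≡ : suc v ≡ suc (v % N) + v / N * N
    v+1≡ = cong suc (m≡m%n+[m/n]*n v N)
  ... | inj₂ r+1≡N = inj₂ (r+1≡N , subst (λ w → w % N ≡ 0 × w / N ≡ suc (v / N)) (sym v+1≡) (digits-unique (suc (v / N)) (>-nonZero⁻¹ N)))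
    where
    v+1≡ : suc v ≡ 0 + suc (v / N) * N
    v+1≡ = trans (cong suc (m≡m%n+[m/n]*n v N)) (cong (_+ v / N * N) r+1≡N)

  digitColour : ℕ → ℕ → ℕ → ℕ
  digitColour α β v = α * (v % N) + β * (v / N)

  digitColour-0 : ∀ α β → digitColour α β 0 ≈ 0
  digitColour-0 α β = cong (_% N) (begin
    α * (0 % N) + β * (0 / N)  ≡⟨ cong₂ (λ r q → α * r + β * q) 0%N≡0 (0/n≡0 N) ⟩
    α * 0 + β * 0              ≡⟨ cong₂ _+_ (*-zeroʳ α) (*-zeroʳ β) ⟩
    0                          ∎)

  digitColour-1-0 : ∀ v → digitColour 1 0 v ≡ v % N
  digitColour-1-0 v = trans (+-identityʳ (1 * (v % N))) (*-identityˡ (v % N))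

  digitColour-suc : ∀ α β v → digitColour α β (suc v) ≈ digitColour α β v + α
                             ⊎ digitColour α β (suc v) ≈ digitColour α β v + (α + β)
  digitColour-suc α β v with suc-digits v
  ... | inj₁ (r≡ , q≡) = inj₁ (cong (_% N) (begin
    α * (suc v % N) + β * (suc v / N)  ≡⟨ cong₂ (λ r q → α * r + β * q) r≡ q≡ ⟩
    α * suc r + β * q                  ≡⟨ step α β r q ⟩
    α * r + β * q + α                  ∎))
    where
    r = v % N
    q = v / N
    step : ∀ α β r q → α * suc r + β * q ≡ α * r + β * q + α
    step = solve-∀
  ... | inj₂ (r+1≡N , r≡ , q≡) = inj₂ (begin
    (α * (suc v % N) + β * (suc v / N)) % N  ≡⟨ cong (_% N) (cong₂ (λ r q → α * r + β * q) r≡ q≡) ⟩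
    (α * 0 + β * suc q) % N                  ≡⟨ cong (_% N) (cong (_+ β * suc q) (*-zeroʳ α)) ⟩
    (β * suc q) % N                          ≡⟨ [m+kn]%n≡m%n (β * suc q) α N ⟨
    (β * suc q + α * N) % N                  ≡⟨ cong (λ m → (β * suc q + α * m) % N) r+1≡N ⟨
    (β * suc q + α * suc r) % N              ≡⟨ cong (_% N) (wrap α β r q) ⟩
    (α * r + β * q + (α + β)) % N            ∎)
    where
    r = v % N
    q = v / N
    wrap : ∀ α β r q → β * suc q + α * suc r ≡ α * r + β * q + (α + β)
    wrap = solve-∀

  digitColour-step : ∀ {α β} → 0 < α → α + β < N → ∀ v → digitColour α β v ≉ digitColour α β (suc v)
  digitColour-step {α} {β} 0<α α+β<N v c≈c′ with digitColour-suc α β v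
  ... | inj₁ c′≈c+α   = ≉-+ _ 0<α (≤-<-trans (m≤m+n α β) α+β<N) (trans c≈c′ c′≈c+α)
  ... | inj₂ c′≈c+α+β = ≉-+ _ (≤-trans 0<α (m≤m+n α β)) α+β<N (trans c≈c′ c′≈c+α+β)

  digits-determined : ∀ α {u v} → u < N * N → v < N * N → u % N ≡ v % N →
                      digitColour α 1 u ≈ digitColour α 1 v → u ≡ v
  digits-determined α {u} {v} u<N² v<N² r≡ cu≈cv = digits-injective r≡ (<⇒≈⇒≡
    (m<n*o⇒m/o<n u<N²) (m<n*o⇒m/o<n v<N²)
    (+-cancelʳ-≈ (u / N) (v / N) {α * (u % N)} (cong (λ r → α * r % N) r≡) q+αr≈))
    where
    swap : ∀ w → digitColour α 1 w ≡ w / N + α * (w % N)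
    swap w = trans (cong (α * (w % N) +_) (*-identityˡ (w / N))) (+-comm _ (w / N))
    q+αr≈ : u / N + α * (u % N) ≈ v / N + α * (v % N)
    q+αr≈ = trans (cong (_% N) (sym (swap u))) (trans cu≈cv (cong (_% N) (swap v)))

  digitColour-orthogonal-1-0 : ∀ α {u v} → u < N * N → v < N * N →
    digitColour 1 0 u ≈ digitColour 1 0 v → digitColour α 1 u ≈ digitColour α 1 v → u ≡ v
  digitColour-orthogonal-1-0 α {u} {v} u<N² v<N² ru≈rv = digits-determined α u<N² v<N² (begin
    u % N                  ≡⟨ m%n%n≡m%n u N ⟨
    u % N % N              ≡⟨ cong (_% N) (digitColour-1-0 u) ⟨
    digitColour 1 0 u % N  ≡⟨ ru≈rv ⟩
    digitColour 1 0 v % N  ≡⟨ cong (_% N) (digitColour-1-0 v) ⟩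
    v % N % N              ≡⟨ m%n%n≡m%n v N ⟩
    v % N                  ∎)

  -- the colourings (α, 1) and (α + 1, 1) differ exactly by the colouring (1, 0)
  digitColour-orthogonal-suc : ∀ α {u v} → u < N * N → v < N * N →
    digitColour α 1 u ≈ digitColour α 1 v → digitColour (suc α) 1 u ≈ digitColour (suc α) 1 v → u ≡ v
  digitColour-orthogonal-suc α {u} {v} u<N² v<N² cu≈cv c′u≈c′v = digits-determined α u<N² v<N²
    (<⇒≈⇒≡ (m%n<n u N) (m%n<n v N) (+-cancelʳ-≈ (u % N) (v % N) cu≈cv r+c≈))
    cu≈cv
    where
    r+c≈ : u % N + digitColour α 1 u ≈ v % N + digitColour α 1 v
    r+c≈ = trans (cong (_% N) (sym (regroup u))) (trans c′u≈c′v (cong (_% N) (regroup v)))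
      where
      regroup : ∀ w → digitColour (suc α) 1 w ≡ w % N + digitColour α 1 w
      regroup w = +-assoc (w % N) (α * (w % N)) (1 * (w / N))

  module _ {t : ℕ} (0<t : 0 < t) (t<N² : t < N * N) where

    private
      q<N : t / N < N
      q<N = m<n*o⇒m/o<n t<N²

      r≡0⇒q≢0 : t % N ≡ 0 → t / N ≢ 0
      r≡0⇒q≢0 r≡0 q≡0 = <⇒≢ 0<t (sym (trans (m≡m%n+[m/n]*n t N) (cong₂ (λ r q → r + q * N) r≡0 q≡0)))

      q≈0⇒q≡0 : t / N ≈ 0 → t / N ≡ 0
      q≈0⇒q≡0 = <⇒≈⇒≡ q<N (>-nonZero⁻¹ N)

    ∣⇒digitColour≉ : ∀ α → N ∣ t → digitColour α 1 t ≉ digitColour α 1 0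
    ∣⇒digitColour≉ α N∣t ct≈c0 = r≡0⇒q≢0 r≡0 (q≈0⇒q≡0 (begin
      t / N % N                  ≡⟨ cong (_% N) (cong₂ _+_ (*-zeroʳ α) (*-identityˡ (t / N))) ⟨
      (α * 0 + 1 * (t / N)) % N  ≡⟨ cong (λ r → (α * r + 1 * (t / N)) % N) r≡0 ⟨
      digitColour α 1 t % N      ≡⟨ trans ct≈c0 (digitColour-0 α 1) ⟩
      0 % N                      ∎))
      where
      r≡0 : t % N ≡ 0
      r≡0 = n∣m⇒m%n≡0 t N N∣t

    r+q≈0 : N ∣ t + t / N → t % N + t / N ≈ 0
    r+q≈0 N∣t+q = begin
      (t % N + t / N) % N               ≡⟨ [m+kn]%n≡m%n _ (t / N) N ⟨
      (t % N + t / N + t / N * N) % N   ≡⟨ cong (_% N) (regroup (t % N) (t / N) N) ⟩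
      (t % N + t / N * N + t / N) % N   ≡⟨ cong (λ w → (w + t / N) % N) (m≡m%n+[m/n]*n t N) ⟨
      (t + t / N) % N                   ≡⟨ n∣m⇒m%n≡0 _ N N∣t+q ⟩
      0                                 ≡⟨ 0%N≡0 ⟨
      0 % N                             ∎
      where
      regroup : ∀ r q n → r + q + q * n ≡ r + q * n + q
      regroup = solve-∀

    ∣+/⇒digitColour-1-0≉ : N ∣ t + t / N → digitColour 1 0 t ≉ digitColour 1 0 0
    ∣+/⇒digitColour-1-0≉ N∣t+q ct≈c0 = r≡0⇒q≢0 r≡0 (q≈0⇒q≡0 (subst (λ r → r + t / N ≈ 0) r≡0 (r+q≈0 N∣t+q)))
      where
      r≡0 : t % N ≡ 0
      r≡0 = begin
        t % N                  ≡⟨ m%n%n≡m%n t N ⟨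
        t % N % N              ≡⟨ cong (_% N) (digitColour-1-0 t) ⟨
        digitColour 1 0 t % N  ≡⟨ trans ct≈c0 (digitColour-0 1 0) ⟩
        0 % N                  ≡⟨ 0%N≡0 ⟩
        0                      ∎

    ∣+/⇒digitColour-suc≈ : ∀ α → N ∣ t + t / N → digitColour (suc α) 1 t ≈ digitColour α 0 t
    ∣+/⇒digitColour-suc≈ α N∣t+q = begin
      digitColour (suc α) 1 t % N          ≡⟨ cong (_% N) (regroup α (t % N) (t / N)) ⟩
      (α * (t % N) + (t % N + t / N)) % N  ≡⟨ +-cong-≈ {α * (t % N)} refl (r+q≈0 N∣t+q) ⟩
      (α * (t % N) + 0) % N                ∎
      where
      regroup : ∀ α r q → suc α * r + 1 * q ≡ α * r + (r + q)
      regroup = solve-∀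

    ∣+/⇒digitColour-2-1≉ : N ∣ t + t / N → digitColour 2 1 t ≉ digitColour 2 1 0
    ∣+/⇒digitColour-2-1≉ N∣t+q ct≈c0 = ∣+/⇒digitColour-1-0≉ N∣t+q (begin
      digitColour 1 0 t % N  ≡⟨ ∣+/⇒digitColour-suc≈ 1 N∣t+q ⟨
      digitColour 2 1 t % N  ≡⟨ trans ct≈c0 (digitColour-0 2 1) ⟩
      0 % N                  ≡⟨ digitColour-0 1 0 ⟨
      digitColour 1 0 0 % N  ∎)

  colouring : ∀ {n} → (ℕ → ℕ) → Colouring n N
  colouring f i = fromℕ< (m%n<n (f (toℕ i)) N)

  colouring-≡⇒≈ : ∀ {n} f (i j : Fin n) → colouring f i ≡ colouring f j → f (toℕ i) ≈ f (toℕ j)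
  colouring-≡⇒≈ {n} f i j ci≡cj = begin
    f (toℕ i) % N            ≡⟨ toℕ-fromℕ< (m%n<n (f (toℕ i)) N) ⟨
    toℕ (colouring {n} f i)  ≡⟨ cong toℕ ci≡cj ⟩
    toℕ (colouring {n} f j)  ≡⟨ toℕ-fromℕ< (m%n<n (f (toℕ j)) N) ⟩
    f (toℕ j) % N            ∎

  colouring-proper : ∀ n .{{_ : NonZero n}} (f : ℕ → ℕ) →
    (∀ v → f v ≉ f (suc v)) → f (n ∸ 1) ≉ f 0 → Proper n (colouring f)
  colouring-proper n f step wrap i j (inj₁ j≡i+1) ci≡cj = next-≉ (toℕ<n i) j≡i+1 (colouring-≡⇒≈ f i j ci≡cj)
    where
    next-≉ : ∀ {x y} → x < n → y ≡ (x + 1) % n → f x ≉ f y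
    next-≉ {x} {y} x<n y≡x+1 with m≤n⇒m<n∨m≡n x<n
    ... | inj₁ x+1<n = subst (λ z → f x ≉ f z) (sym (trans y≡x+1 (trans (cong (_% n) (+-comm x 1)) (m<n⇒m%n≡m x+1<n)))) (step x)
    ... | inj₂ x+1≡n = subst₂ (λ a b → f a ≉ f b) (sym (cong pred x+1≡n)) (sym y≡0) wrap
      where
      y≡0 : y ≡ 0
      y≡0 = trans y≡x+1 (trans (cong (_% n) (trans (+-comm x 1) x+1≡n)) (n%n≡0 n))
  colouring-proper n f step wrap i j (inj₂ i≡j+1) ci≡cj = colouring-proper n f step wrap j i (inj₁ i≡j+1) (sym ci≡cj)

  colouring-orthogonal : ∀ {n} → n ≤ N * N → (f g : ℕ → ℕ) →
    (∀ {u v} → u < N * N → v < N * N → f u ≈ f v → g u ≈ g v → u ≡ v) →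
    Orthogonal (colouring {n} f) (colouring g)
  colouring-orthogonal n≤N² f g separates u v fu≡fv gu≡gv = toℕ-injective (separates
    (<-≤-trans (toℕ<n u) n≤N²) (<-≤-trans (toℕ<n v) n≤N²)
    (colouring-≡⇒≈ f u v fu≡fv) (colouring-≡⇒≈ g u v gu≡gv))

orthColouring⇒≤² : ∀ n .{{_ : NonZero n}} m → HasOrthColouring n m → n ≤ m * m
orthColouring⇒≤² n m (c₁ , c₂ , _ , _ , orthogonal) = ≮⇒≥ λ m²<n →
  let i , j , i<j , pairᵢ≡pairⱼ = pigeonhole m²<n (λ v → combine (c₁ v) (c₂ v))
      c₁ᵢ≡c₁ⱼ , c₂ᵢ≡c₂ⱼ = combine-injective (c₁ i) (c₂ i) (c₁ j) (c₂ j) pairᵢ≡pairⱼ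
  in Fin.<⇒≢ i<j (orthogonal i j c₁ᵢ≡c₁ⱼ c₂ᵢ≡c₂ⱼ)

16<n≤N²⇒3<N : ∀ {n N} → 16 < n → n ≤ N * N → 3 < N
16<n≤N²⇒3<N 16<n n≤N² = ≰⇒> λ N≤3 → <⇒≱ 16<n (≤-trans n≤N² (≤-trans (*-mono-≤ N≤3 N≤3) (m≤m+n 9 7)))

lemma2 : (n N : ℕ) → .{{_ : NonZero n}} → .{{_ : NonZero N}} → 16 < n → IsCeilSqrt n N →
    (N ∣ (n ∸ 1)) ⊎ (N ∣ ((n ∸ 1) + (n ∸ 1) / N)) →
    OChiCycle≡ n N
lemma2 n N 16<n (n≤N² , below) divisible =
  upper divisible , λ m m<N orth → <⇒≱ (below m m<N) (orthColouring⇒≤² n m orth)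
  where
  open Residues N
  3<N : 3 < N
  3<N = 16<n≤N²⇒3<N 16<n n≤N²
  0<t : 0 < n ∸ 1
  0<t = m<n⇒0<n∸m (≤-trans (s≤s (s≤s z≤n)) 16<n)
  t<N² : n ∸ 1 < N * N
  t<N² = <-≤-trans (m≤pred[n]⇒suc[m]≤n ≤-refl) n≤N²
  step : ∀ α β → 0 < α → α + β ≤ 3 → ∀ v → digitColour α β v ≉ digitColour α β (suc v)
  step α β 0<α α+β≤3 = digitColour-step 0<α (≤-<-trans α+β≤3 3<N)
  upper : (N ∣ (n ∸ 1)) ⊎ (N ∣ ((n ∸ 1) + (n ∸ 1) / N)) → HasOrthColouring n N
  upper (inj₁ N∣t) = colouring (digitColour 1 1) , colouring (digitColour 2 1)
    , colouring-proper n _ (step 1 1 z<s (s≤s (s≤s z≤n))) (∣⇒digitColour≉ 0<t t<N² 1 N∣t)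
    , colouring-proper n _ (step 2 1 z<s ≤-refl) (∣⇒digitColour≉ 0<t t<N² 2 N∣t)
    , colouring-orthogonal n≤N² _ _ (digitColour-orthogonal-suc 1)
  upper (inj₂ N∣t+q) = colouring (digitColour 1 0) , colouring (digitColour 2 1)
    , colouring-proper n _ (step 1 0 z<s (s≤s z≤n)) (∣+/⇒digitColour-1-0≉ 0<t t<N² N∣t+q)
    , colouring-proper n _ (step 2 1 z<s ≤-refl) (∣+/⇒digitColour-2-1≉ 0<t t<N² N∣t+q)
    , colouring-orthogonal n≤N² _ _ (digitColour-orthogonal-1-0 2)
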